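{- Let $\mathcal{A}=(Q,\delta,I,F)$ be a Büchi automaton, $\alpha\in\Sigma^\omega$, and let $\rho = S_0\dots S_m\,(S_{m+1},O_{m+1},f_{m+1},i_{m+1})\,(S_{m+2},O_{m+2},f_{m+2},i_{m+2})\dots$ be an accepting super-tight run of $\mathrm{Schewe}(\mathcal{A})$ on $\alpha$ (with $S_0,\dots,S_m$ in the waiting part and all later macrostates in the tight part). Then there is a trunk $\tau=C_{m+1}C_{m+2}\dots$ of $\rho$ such that, moreover, for every $k>m$ and every state $q_k\in C_k$ there is a state $q_{k+1}\in C_{k+1}$ with $f_k(q_k)=f_{k+1}(q_{k+1})$.
   Context: Fix a finite nonempty alphabet $\Sigma$; infinite words are $\alpha=\alpha_0\alpha_1\cdots\in\Sigma^\omega$. A Büchi automaton (BA) is $\mathcal{A}=(Q,\delta,I,F)$ with finite state set $Q$, transition function $\delta:Q\times\Sigma\to 2^Q$ (extended to sets by $\delta(P,a)=\bigcup_{p\in P}\delta(p,a)$), initial states $I\subseteq Q$ and accepting states $F\subseteq Q$. A run from $q$ on $\alpha$ is a sequence $\rho_0\rho_1\cdots$ with $\rho_0=q$ and $\rho_{i+1}\in\delta(\rho_i,\alpha_i)$; it is accepting if some state of $F$ occurs in it infinitely often; $\mathcal{L}(\mathcal{A})$ is the set of words with an accepting run from a state of $I$. Let $n=|Q|$. Run DAG and ranks: the run DAG $\mathcal{G}_\alpha$ of $\mathcal{A}$ over $\alpha$ has vertices $(q,i)\in Q\times\omega$ such that some run of $\mathcal{A}$ from a state of $I$ on $\alpha$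 has $\rho_i=q$, and edges $((q,i),(q',i+1))$ with $q'\in\delta(q,\alpha_i)$. A vertex is accepting if its state is in $F$, finite if only finitely many vertices are reachable from it, endangered if it cannot reach an accepting vertex. Let $\mathcal{G}^0=\mathcal{G}_\alpha$, $j=0$, and repeat until a fixpoint or for at most $2n+1$ steps: assign rank $j$ to all finite vertices of $\mathcal{G}^j$ and let $\mathcal{G}^{j+1}$ be $\mathcal{G}^j$ without them; assign rank $j+1$ to all endangered vertices of $\mathcal{G}^{j+1}$ and let $\mathcal{G}^{j+2}$ be $\mathcal{G}^{j+1}$ without them; set $j:=j+2$. Remaining vertices get rank $\omega$. Write $\mathrm{rank}_\alpha(q,i)$ for the rank of $(q,i)$. Rankings: a (level) ranking is $f:Q\to\{0,\dots,2n\}$ with $f(q)$ even for every $q\in F$; $\mathrm{rank}(f)=\max_{q\in Q}f(q)$. For $S\subseteq Q$, $f$ is $S$-tight if $\mathrm{rank}(f)$ is odd, $\{f(s):s\in S\}\supseteq\{1,3,\dots,\mathrm{rank}(f)\}$, and $f(q)=0$ for all $q\notin S$. Schewe's construction $\mathrm{Schewe}(\mathcal{A})=(Q_1\cup Q_2,\delta_1\cup\delta_2\cup\delta_3,I',F')$: waiting part $Q_1=2^Q$; tight part $Q_2$ = set of tuples $(S,O,f,i)$ with $S,O\subseteq Q$, $f$ an $S$-tight ranking, $i\in\{0,2,\dots,2n-2\}$, $O\subseteq S\cap f^{ -1}(i)$; $I'=\{I\}$; $\delta_1(S,a)=\{\delta(S,a)\}$ and $\delta_2(S,a)=\{(S',\emptyset,f,0):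 S'=\delta(S,a),\ f\text{ is }S'\text{ -tight}\}$ for $S\in Q_1$; $(S',O',f',i')\in\delta_3((S,O,f,i),a)$ iff $S'=\delta(S,a)$, $f'(q')\le f(q)$ for all $q\in S$, $q'\in\delta(q,a)$, $\mathrm{rank}(f')=\mathrm{rank}(f)$, and either ($O=\emptyset$, $i'=(i+2)\bmod(\mathrm{rank}(f')+1)$, $O'=S'\cap f'^{ -1}(i')$) or ($O\neq\emptyset$, $i'=i$, $O'=\delta(O,a)\cap f'^{ -1}(i)$); $F'=\{\emptyset\}\cup\{(S,\emptyset,f,i)\in Q_2\}$. Runs and acceptance are as for BAs. Super-tight runs: an accepting run $\rho=S_0\dots S_m(S_{m+1},O_{m+1},f_{m+1},i_{m+1})\dots$ of $\mathrm{Schewe}(\mathcal{A})$ on $\alpha$ (moving from the waiting part to the tight part after position $m$) is super-tight if $f_k(q)=\mathrm{rank}_\alpha(q,k)$ for all $k>m$ and all $q\in S_k$. Tight cores and trunks: for $k>m$, a set $C_k\subseteq S_k$ is a tight core of $f_k$ (and of the macrostate $(S_k,O_k,f_k,i_k)$) if $f_k(C_k)=\{1,3,\dots,\mathrm{rank}(f_k)\}$ and the restriction of $f_k$ to $C_k$ is injective. An infinite sequence $C_{m+1}C_{m+2}\dots$ is a trunk of $\rho$ if for all $k>m$, $C_k$ is a tight core of $f_k$ and there is a bijection $\theta:C_k\to C_{k+1}$ with $\theta(q)\in\delta(q,\alpha_k)$ for all $q\in C_k$. -}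

module Defs where

open import Data.Nat using (ℕ; zero; suc; _+_; _*_; _≤_; _<_; _%_; _⊔_)
open import Data.Nat.Properties using (_≟_)
open import Data.Bool using (Bool; true; false; if_then_else_)
open import Data.Fin using (Fin)
open import Data.Fin.Subset using (Subset; _∈_; _∉_; _⊆_; _∩_; ⊥)
open import Data.Fin.Subset.Properties using (_∈?_)
open import Data.Fin.Properties using (any?)
open import Data.Vec using (tabulate)
open import Data.Product using (Σ; _×_; _,_; proj₁; proj₂; ∃)
open import Data.List using (List)
open import Data.Sum using (_⊎_)
open import Data.List.Membership.Propositional using () renaming (_∈_ to _∈ₗ_)
open import Relation.Nullary using (¬_; does)
open import Relation.Nullary.Decidable using (_×-dec_)
open import Relation.Binary.PropositionalEquality using (_≡_)

isEven : ℕ → Bool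
isEven zero = true
isEven (suc n) = if isEven n then false else true

Even : ℕ → Set
Even k = isEven k ≡ true

Odd : ℕ → Set
Odd k = isEven k ≡ false

record BA (n σ : ℕ) : Set where
  field
    δ : Fin n → Fin σ → Subset n
    I : Subset n
    F : Subset n

open BA public

Word : ℕ → Set
Word σ = ℕ → Fin σ

-- δ extended to sets of states: δ(P,a) = ⋃_{p ∈ P} δ(p,a)
post : ∀ {n σ} → BA n σ → Subset n → Fin σ → Subset n
post A P a = tabulate λ q' → does (any? λ p → (p ∈? P) ×-dec (q' ∈? δ A p a))

IsInitRun : ∀ {n σ} → BA n σ → Word σ → (ℕ → Fin n) → Set
IsInitRun A α ρ = (ρ 0 ∈ I A) × (∀ j → ρ (suc j) ∈ δ A (ρ j) (α j))

Vtx : ℕ → Set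
Vtx n = Fin n × ℕ

IsVertex : ∀ {n σ} → BA n σ → Word σ → Vtx n → Set
IsVertex A α (q , i) = Σ (ℕ → _) λ ρ → IsInitRun A α ρ × (ρ i ≡ q)

Edge : ∀ {n σ} → BA n σ → Word σ → Vtx n → Vtx n → Set
Edge A α (q , i) (q' , i') =
  IsVertex A α (q , i) × IsVertex A α (q' , i') × (i' ≡ suc i) × (q' ∈ δ A q (α i))

data Reach {n σ} (A : BA n σ) (α : Word σ) (P : Vtx n → Set) : Vtx n → Vtx n → Set where
  here : ∀ {v} → P v → Reach A α P v v
  step : ∀ {v w u} → P v → Edge A α v w → Reach A α P w u → Reach A α P v u

FiniteIn : ∀ {n σ} → BA n σ → Word σ → (Vtx n → Set) → Vtx n → Set
FiniteIn A α P v = Σ (List (Vtx _)) λ L → ∀ w → Reach A α P v w → w ∈ₗ L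

EndangeredIn : ∀ {n σ} → BA n σ → Word σ → (Vtx n → Set) → Vtx n → Set
EndangeredIn A α P v = ∀ w → Reach A α P v w → proj₁ w ∉ F A

-- The graphs G^j (as vertex predicates) and the vertices removed at step j
-- (i.e. receiving rank j): finite ones for even j, endangered ones for odd j.
mutual
  G : ∀ {n σ} → BA n σ → Word σ → ℕ → Vtx n → Set
  G A α zero v = IsVertex A α v
  G A α (suc j) v = G A α j v × ¬ Removed A α j v

  Removed : ∀ {n σ} → BA n σ → Word σ → ℕ → Vtx n → Set
  Removed A α j v =
    if isEven j then FiniteIn A α (G A α j) v else EndangeredIn A α (G A α j) v

-- rank_α(q,i) = r  (for a finite rank r; rank ω is never equal to any r)
RankIs : ∀ {n σ} → BA n σ → Word σ → Fin n → ℕ → ℕ → Set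
RankIs A α q i r = G A α r (q , i) × Removed A α r (q , i)

maxF : ∀ {n} → (Fin n → ℕ) → ℕ
maxF {zero} f = 0
maxF {suc n} f = f Fin.zero ⊔ maxF (λ q → f (Fin.suc q))

rankF : ∀ {n} → (Fin n → ℕ) → ℕ
rankF = maxF

IsRanking : ∀ {n σ} → BA n σ → (Fin n → ℕ) → Set
IsRanking {n} A f = (∀ q → f q ≤ 2 * n) × (∀ q → q ∈ F A → Even (f q))

-- f is S-tight (f assumed to be a ranking)
IsTight : ∀ {n} → Subset n → (Fin n → ℕ) → Set
IsTight S f =
  Odd (rankF f)
  × (∀ j → Odd j → j ≤ rankF f → ∃ λ s → s ∈ S × f s ≡ j)
  × (∀ q → q ∉ S → f q ≡ 0)

preimage : ∀ {n} → (Fin n → ℕ) → ℕ → Subset n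
preimage f i = tabulate λ q → does (f q ≟ i)

record TState (n : ℕ) : Set where
  constructor ⟨_,_,_,_⟩
  field
    S : Subset n
    O : Subset n
    f : Fin n → ℕ
    i : ℕ

data Macro (n : ℕ) : Set where
  waiting : Subset n → Macro n
  tight : TState n → Macro n

InQ2 : ∀ {n σ} → BA n σ → TState n → Set
InQ2 {n} A ⟨ S , O , f , i ⟩ =
  IsRanking A f × IsTight S f × Even i × i < 2 * n × O ⊆ (S ∩ preimage f i)

data Step {n σ} (A : BA n σ) : Macro n → Fin σ → Macro n → Set where
  δ₁ : ∀ {S S' a} → S' ≡ post A S a → Step A (waiting S) a (waiting S')
  δ₂ : ∀ {S a S' O' f' i'} → InQ2 A ⟨ S' , O' , f' , i' ⟩ →
       S' ≡ post A S a → O' ≡ ⊥ → i' ≡ 0 →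
       Step A (waiting S) a (tight ⟨ S' , O' , f' , i' ⟩)
  δ₃ : ∀ {S O f i S' O' f' i' a} →
       InQ2 A ⟨ S' , O' , f' , i' ⟩ →
       S' ≡ post A S a →
       (∀ q q' → q ∈ S → q' ∈ δ A q a → f' q' ≤ f q) →
       rankF f' ≡ rankF f →
       ((O ≡ ⊥ × i' ≡ (i + 2) % suc (rankF f') × O' ≡ S' ∩ preimage f' i')
        ⊎ (¬ (O ≡ ⊥) × i' ≡ i × O' ≡ post A O a ∩ preimage f' i)) →
       Step A (tight ⟨ S , O , f , i ⟩) a (tight ⟨ S' , O' , f' , i' ⟩)

AccMacro : ∀ {n} → Macro n → Set
AccMacro (waiting S) = S ≡ ⊥
AccMacro (tight t) = TState.O t ≡ ⊥

IsScheweRun : ∀ {n σ} → BA n σ → Word σ → (ℕ → Macro n) → Set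
IsScheweRun A α ρ = (ρ 0 ≡ waiting (I A)) × (∀ k → Step A (ρ k) (α k) (ρ (suc k)))

IsAcceptingScheweRun : ∀ {n σ} → BA n σ → Word σ → (ℕ → Macro n) → Set
IsAcceptingScheweRun A α ρ =
  IsScheweRun A α ρ × (∀ N → ∃ λ k → N ≤ k × AccMacro (ρ k))

glue : ∀ {n} → ℕ → (ℕ → Subset n) → (ℕ → TState n) → ℕ → Macro n
glue m W T k with k Data.Nat.≤ᵇ m
... | true = waiting (W k)
... | false = tight (T k)

SuperTight : ∀ {n σ} → BA n σ → Word σ → ℕ → (ℕ → TState n) → Set
SuperTight A α m T =
  ∀ k → m < k → ∀ q → q ∈ TState.S (T k) → RankIs A α q k (TState.f (T k) q)

IsTightCore : ∀ {n} → TState n → Subset n → Set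
IsTightCore ⟨ S , O , f , i ⟩ C =
  C ⊆ S
  × (∀ q → q ∈ C → Odd (f q) × f q ≤ rankF f)
  × (∀ j → Odd j → j ≤ rankF f → ∃ λ q → q ∈ C × f q ≡ j)
  × (∀ p q → p ∈ C → q ∈ C → f p ≡ f q → p ≡ q)

BijStep : ∀ {n σ} → BA n σ → Fin σ → Subset n → Subset n → Set
BijStep {n} A a C C' =
  Σ ((q : Fin n) → q ∈ C → Fin n) λ θ →
    (∀ q (h : q ∈ C) → θ q h ∈ C')
    × (∀ q (h : q ∈ C) → θ q h ∈ δ A q a)
    × (∀ p q (hp : p ∈ C) (hq : q ∈ C) → θ p hp ≡ θ q hq → p ≡ q)
    × (∀ q' → q' ∈ C' → ∃ λ q → Σ (q ∈ C) λ h → θ q h ≡ q')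

IsTrunk : ∀ {n σ} → BA n σ → Word σ → ℕ → (ℕ → TState n) → (ℕ → Subset n) → Set
IsTrunk A α m T C =
  ∀ k → m < k → IsTightCore (T k) (C k) × BijStep A (α k) (C k) (C (suc k))

-- In a super-tight run, f k q is the rank of the vertex (q , k) of the run DAG. A vertex of odd
-- rank 1 + j survives into G^(1+j), so it is not finite in G^j. Were all its successors of rank
-- at most j, it would be: those of rank j are finite in G^j and the others are not in G^j at all.
-- Since a tight transition never increases f, some successor therefore keeps the rank 1 + j.
-- Sending every state of odd rank to such a successor is injective on a tight core (f is
-- injective there and preserved), so the images of a tight core of f (m + 1) under these maps
-- form a trunk, and ranks are preserved along it by construction.

module Submission where

open import Defs
open import Data.Nat using (ℕ; suc; _<_; _≤_)
open import Data.Fin.Subset using (Subset; _∈_)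
open import Data.Product using (Σ; _×_; _,_; ∃)
open import Relation.Binary.PropositionalEquality using (_≡_)

open import Level using (0ℓ)
open import Function.Base using (_∘_)
open import Function.Bundles using (Equivalence)
open import Data.Bool using (true; false)
import Data.Bool.Properties as Bool
open import Data.Nat using (zero; _≟_; _<?_; _≤ᵇ_; _≤′_; ≤′-refl; ≤′-step)
open import Data.Nat.Properties
  using ( ≤-refl; ≤-trans; ≤-pred; ≤∧≢⇒<; <⇒≱; <-irrefl; ≤ᵇ⇒≤; ≤⇒≤′
        ; m<n⇒m<1+n; m<1+n⇒m<n∨m≡n; m≤n⇒m<n∨m≡n; m≤m⊔n; m≤n⊔m )
open import Data.Fin as Fin using (Fin)
open import Data.Fin.Properties using (any?)
open import Data.Fin.Subset using (_⊆_)
open import Data.Fin.Subset.Properties using (_∈?_)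
open import Data.Vec using (tabulate)
open import Data.Vec.Properties using (lookup⇒[]=; []=⇒lookup; lookup∘tabulate)
open import Data.Maybe using (Maybe; just; nothing)
import Data.Maybe.Properties as Maybe
open import Data.List using (List; []; _∷_; concatMap; allFin)
open import Data.List.Membership.Propositional using (lose) renaming (_∈_ to _∈ₗ_)
open import Data.List.Membership.Propositional.Properties using (∈-concatMap⁺; ∈-allFin)
open import Data.List.Relation.Unary.Any using (here; there)
open import Data.Product using (proj₁; proj₂)
open import Data.Sum using (inj₁; inj₂)
open import Relation.Nullary using (¬_; yes; no; does; contradiction)
open import Relation.Nullary.Decidable using (_×-dec_; dec-true)
open import Relation.Unary using (Pred; Decidable)
open import Relation.Binary.PropositionalEquality
  using (refl; sym; trans; cong; subst; subst₂; module ≡-Reasoning)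

module _ {n : ℕ} {P : Pred (Fin n) 0ℓ} (P? : Decidable P) where

  ∈-tabulate-does⁺ : ∀ {q} → P q → q ∈ tabulate (does ∘ P?)
  ∈-tabulate-does⁺ {q} p =
    lookup⇒[]= q _ (trans (lookup∘tabulate (does ∘ P?) q) (dec-true (P? q) p))

  ∈-tabulate-does⁻ : ∀ {q} → q ∈ tabulate (does ∘ P?) → P q
  ∈-tabulate-does⁻ {q} q∈ with P? q | trans (sym (lookup∘tabulate _ q)) ([]=⇒lookup q∈)
  ... | yes p | _ = p

  first : Maybe (Fin n)
  first with any? P?
  ... | yes (x , _) = just x
  ... | no _ = nothing

  first-sound : ∀ {x} → first ≡ just x → P x
  first-sound eq with any? P? | eq
  ... | yes (_ , px) | refl = px

  first-complete : ∀ {x} → P x → ∃ λ y → first ≡ just y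
  first-complete px with any? P?
  ... | yes (y , _) = y , refl
  ... | no ∄ = contradiction (_ , px) ∄

  choose : Fin n → Fin n
  choose default with any? P?
  ... | yes (x , _) = x
  ... | no _ = default

  choose-sound : ∀ default → ¬ ¬ ∃ P → P (choose default)
  choose-sound default ¬¬∃ with any? P?
  ... | yes (_ , px) = px
  ... | no ∄ = contradiction ∄ ¬¬∃

∈-post : ∀ {n σ} (A : BA n σ) {S a q q'} → q ∈ S → q' ∈ δ A q a → q' ∈ post A S a
∈-post A {S} {a} {q} q∈S q'∈δq =
  ∈-tabulate-does⁺ (λ q' → any? λ p → (p ∈? S) ×-dec (q' ∈? δ A p a)) (q , q∈S , q'∈δq)

≤-maxF : ∀ {n} (f : Fin n → ℕ) q → f q ≤ maxF f
≤-maxF {suc n} f Fin.zero = m≤m⊔n _ _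
≤-maxF {suc n} f (Fin.suc q) = ≤-trans (≤-maxF (f ∘ Fin.suc) q) (m≤n⊔m (f Fin.zero) _)

Odd? : Decidable Odd
Odd? j = isEven j Bool.≟ false

odd⇒suc-even : ∀ {j} → Odd j → ∃ λ j' → j ≡ suc j' × Even j'
odd⇒suc-even {suc j} odd with isEven j in even
... | true = j , refl , even

module RunDAG {n σ} (A : BA n σ) (α : Word σ) where

  G-antitone : ∀ {i j v} → i ≤′ j → G A α j v → G A α i v
  G-antitone ≤′-refl g = g
  G-antitone (≤′-step i≤′j) g = G-antitone i≤′j (proj₁ g)

  removed-even⁺ : ∀ {j v} → Even j → FiniteIn A α (G A α j) v → Removed A α j v
  removed-even⁺ even fin rewrite even = fin

  removed-even⁻ : ∀ {j v} → Even j → Removed A α j v → FiniteIn A α (G A α j) v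
  removed-even⁻ even removed rewrite even = removed

  reach-source : ∀ {P : Vtx n → Set} {v u} → Reach A α P v u → P v
  reach-source (here p) = p
  reach-source (step p _ _) = p

  successors-rank-≤⇒finite : ∀ {j q k} → Even j →
    (∀ q' → q' ∈ δ A q (α k) → ∃ λ r → RankIs A α q' (suc k) r × r ≤ j) →
    FiniteIn A α (G A α j) (q , k)
  successors-rank-≤⇒finite {j} {q} {k} even ranked =
    (q , k) ∷ concatMap (proj₁ ∘ successorReach) (allFin n) , reachable
    where
    successorReach : ∀ q' → Σ (List (Vtx n)) λ L →
      q' ∈ δ A q (α k) → ∀ u → Reach A α (G A α j) (q' , suc k) u → u ∈ₗ L
    successorReach q' with q' ∈? δ A q (α k)
    ... | no q'∉δq = [] , λ q'∈δq → contradiction q'∈δq q'∉δq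
    ... | yes q'∈δq with ranked q' q'∈δq
    ... | r , (_ , removed) , r≤j with m≤n⇒m<n∨m≡n r≤j
    ... | inj₂ refl = let (L , ⊆L) = removed-even⁻ even removed in L , λ _ → ⊆L
    ... | inj₁ r<j = [] , λ _ _ reach →
          contradiction removed (proj₂ (G-antitone (≤⇒≤′ r<j) (reach-source reach)))
    reachable : ∀ u → Reach A α (G A α j) (q , k) u → u ∈ₗ _
    reachable u (here _) = here refl
    reachable u (step {w = q' , _} _ (_ , _ , refl , q'∈δq) reach) =
      there (∈-concatMap⁺ (proj₁ ∘ successorReach)
        (lose (∈-allFin q') (proj₂ (successorReach q') q'∈δq u reach)))

module _ {n σ} {A : BA n σ} {a : Fin σ} {s t : TState n} where

  tightStep-post : Step A (tight s) a (tight t) → TState.S t ≡ post A (TState.S s) a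
  tightStep-post (δ₃ _ S'≡ _ _ _) = S'≡

  tightStep-≤ : Step A (tight s) a (tight t) →
    ∀ {q q'} → q ∈ TState.S s → q' ∈ δ A q a → TState.f t q' ≤ TState.f s q
  tightStep-≤ (δ₃ _ _ ≤f _ _) = ≤f _ _

  tightStep-rank : Step A (tight s) a (tight t) → rankF (TState.f t) ≡ rankF (TState.f s)
  tightStep-rank (δ₃ _ _ _ rank≡ _) = rank≡

step-InQ2 : ∀ {n σ} {A : BA n σ} {x a t} → Step A x a (tight t) → InQ2 A t
step-InQ2 (δ₂ inQ2 _ _ _) = inQ2
step-InQ2 (δ₃ inQ2 _ _ _ _) = inQ2

module _ {n : ℕ} (S : Subset n) (f : Fin n → ℕ) where

  HasRank : ℕ → Pred (Fin n) 0ℓ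
  HasRank j s = s ∈ S × f s ≡ j

  hasRank? : ∀ j → Decidable (HasRank j)
  hasRank? j s = (s ∈? S) ×-dec (f s ≟ j)

  representative : ℕ → Maybe (Fin n)
  representative j = first (hasRank? j)

  IsOddRepresentative : Pred (Fin n) 0ℓ
  IsOddRepresentative q = q ∈ S × Odd (f q) × representative (f q) ≡ just q

  isOddRepresentative? : Decidable IsOddRepresentative
  isOddRepresentative? q =
    (q ∈? S) ×-dec Odd? (f q) ×-dec Maybe.≡-dec Fin._≟_ (representative (f q)) (just q)

  oddRepresentatives : Subset n
  oddRepresentatives = tabulate (does ∘ isOddRepresentative?)

  oddRepresentatives-tightCore : ∀ {O i} → IsTight S f →
    IsTightCore ⟨ S , O , f , i ⟩ oddRepresentatives
  oddRepresentatives-tightCore (_ , covered , _) =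
      proj₁ ∘ represents _
    , (λ q q∈C → proj₁ (proj₂ (represents q q∈C)) , ≤-maxF f q)
    , cover
    , injective
    where
    represents : ∀ q → q ∈ oddRepresentatives → IsOddRepresentative q
    represents q = ∈-tabulate-does⁻ isOddRepresentative?
    cover : ∀ j → Odd j → j ≤ rankF f → ∃ λ q → q ∈ oddRepresentatives × f q ≡ j
    cover j odd j≤rank with covered j odd j≤rank
    ... | s , s∈S , fs≡j with first-complete (hasRank? j) (s∈S , fs≡j)
    ... | q , rep≡q with first-sound (hasRank? j) rep≡q
    ... | q∈S , refl = q , ∈-tabulate-does⁺ isOddRepresentative? (q∈S , odd , rep≡q) , refl
    injective : ∀ p q → p ∈ oddRepresentatives → q ∈ oddRepresentatives → f p ≡ f q → p ≡ q
    injective p q p∈C q∈C fp≡fq = Maybe.just-injective (begin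
      just p              ≡⟨ sym (proj₂ (proj₂ (represents p p∈C))) ⟩
      representative (f p) ≡⟨ cong representative fp≡fq ⟩
      representative (f q) ≡⟨ proj₂ (proj₂ (represents q q∈C)) ⟩
      just q              ∎)
      where open ≡-Reasoning

module _ {n : ℕ} (θ : Fin n → Fin n) (C : Subset n) where

  InImage : Pred (Fin n) 0ℓ
  InImage q' = ∃ λ q → q ∈ C × θ q ≡ q'

  inImage? : Decidable InImage
  inImage? q' = any? λ q → (q ∈? C) ×-dec (θ q Fin.≟ q')

  image : Subset n
  image = tabulate (does ∘ inImage?)

  ∈-image⁺ : ∀ {q} → q ∈ C → θ q ∈ image
  ∈-image⁺ q∈C = ∈-tabulate-does⁺ inImage? (_ , q∈C , refl)

  ∈-image⁻ : ∀ {q'} → q' ∈ image → InImage q'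
  ∈-image⁻ = ∈-tabulate-does⁻ inImage?

SameRankSuccessor : ∀ {n σ} → BA n σ → Fin σ → TState n → TState n → (Fin n → Fin n) → Set
SameRankSuccessor A a s t θ = ∀ {q} → q ∈ TState.S s → Odd (TState.f s q) →
  θ q ∈ δ A q a × TState.f t (θ q) ≡ TState.f s q

module ImageOfCore {n σ} (A : BA n σ) (a : Fin σ) (s t : TState n) {θ : Fin n → Fin n}
         (sameRank : SameRankSuccessor A a s t θ) where

  sameRank-on-core : ∀ {C q} → IsTightCore s C → q ∈ C →
    θ q ∈ δ A q a × TState.f t (θ q) ≡ TState.f s q
  sameRank-on-core (C⊆S , oddRank , _) q∈C = sameRank (C⊆S q∈C) (proj₁ (oddRank _ q∈C))

  image-tightCore : Step A (tight s) a (tight t) →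
    ∀ {C} → IsTightCore s C → IsTightCore t (image θ C)
  image-tightCore transition {C} core@(C⊆S , oddRank , covered , injective) =
    image⊆S , oddRank' , covered' , injective'
    where
    open TState
    image⊆S : image θ C ⊆ S t
    image⊆S q'∈ with ∈-image⁻ θ C q'∈
    ... | q , q∈C , refl = subst (θ q ∈_) (sym (tightStep-post transition))
      (∈-post A (C⊆S q∈C) (proj₁ (sameRank-on-core core q∈C)))
    oddRank' : ∀ q' → q' ∈ image θ C → Odd (f t q') × f t q' ≤ rankF (f t)
    oddRank' q' q'∈ with ∈-image⁻ θ C q'∈
    ... | q , q∈C , refl
      rewrite proj₂ (sameRank-on-core core q∈C) | tightStep-rank transition = oddRank q q∈C
    covered' : ∀ j → Odd j → j ≤ rankF (f t) → ∃ λ q' → q' ∈ image θ C × f t q' ≡ j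
    covered' j odd j≤rank with covered j odd (subst (j ≤_) (tightStep-rank transition) j≤rank)
    ... | q , q∈C , fq≡j =
      θ q , ∈-image⁺ θ C q∈C , trans (proj₂ (sameRank-on-core core q∈C)) fq≡j
    injective' : ∀ p' q' → p' ∈ image θ C → q' ∈ image θ C → f t p' ≡ f t q' → p' ≡ q'
    injective' p' q' p'∈ q'∈ ft≡ with ∈-image⁻ θ C p'∈ | ∈-image⁻ θ C q'∈
    ... | p , p∈C , refl | q , q∈C , refl = cong θ (injective p q p∈C q∈C (begin
      f s p     ≡⟨ sym (proj₂ (sameRank-on-core core p∈C)) ⟩
      f t (θ p) ≡⟨ ft≡ ⟩
      f t (θ q) ≡⟨ proj₂ (sameRank-on-core core q∈C) ⟩
      f s q     ∎))
      where open ≡-Reasoning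

  image-bijStep : ∀ {C} → IsTightCore s C → BijStep A a C (image θ C)
  image-bijStep {C} core@(_ , _ , _ , injective) =
      (λ q _ → θ q)
    , (λ _ → ∈-image⁺ θ C)
    , (λ _ → proj₁ ∘ sameRank-on-core core)
    , (λ p q p∈C q∈C θp≡θq → injective p q p∈C q∈C (begin
        TState.f s p       ≡⟨ sym (proj₂ (sameRank-on-core core p∈C)) ⟩
        TState.f t (θ p)   ≡⟨ cong (TState.f t) θp≡θq ⟩
        TState.f t (θ q)   ≡⟨ proj₂ (sameRank-on-core core q∈C) ⟩
        TState.f s q       ∎))
    , λ q' q'∈ → let (q , q∈C , θq≡q') = ∈-image⁻ θ C q'∈ in q , q∈C , θq≡q'
    where open ≡-Reasoning

module SuperTightRun {n σ} (A : BA n σ) (α : Word σ) (m : ℕ)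
  (W : ℕ → Subset n) (T : ℕ → TState n)
  (run : IsScheweRun A α (glue m W T)) (super : SuperTight A α m T) where

  open RunDAG A α

  S : ℕ → Subset n
  S k = TState.S (T k)

  f : ℕ → Fin n → ℕ
  f k = TState.f (T k)

  glue-tight : ∀ {k} → m < k → glue m W T k ≡ tight (T k)
  glue-tight {k} m<k with k ≤ᵇ m in k≤ᵇm
  ... | true = contradiction (≤ᵇ⇒≤ k m (Equivalence.from Bool.T-≡ k≤ᵇm)) (<⇒≱ m<k)
  ... | false = refl

  tightStep : ∀ {k} → m < k → Step A (tight (T k)) (α k) (tight (T (suc k)))
  tightStep {k} m<k = subst₂ (λ x y → Step A x (α k) y)
    (glue-tight m<k) (glue-tight (m<n⇒m<1+n m<k)) (proj₂ run k)

  initialCore : Subset n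
  initialCore = oddRepresentatives (S (suc m)) (f (suc m))

  initialCore-tightCore : IsTightCore (T (suc m)) initialCore
  initialCore-tightCore =
    oddRepresentatives-tightCore _ _ {TState.O (T (suc m))} {TState.i (T (suc m))}
      (proj₁ (proj₂ (step-InQ2 (subst (Step A _ (α m)) (glue-tight ≤-refl) (proj₂ run m)))))

  sameRank-exists : ∀ {k q} → m < k → q ∈ S k → Odd (f k q) →
    ¬ ¬ ∃ λ q' → q' ∈ δ A q (α k) × f (suc k) q' ≡ f k q
  sameRank-exists {k} {q} m<k q∈S odd ∄ with odd⇒suc-even odd
  ... | j , fq≡1+j , even =
    proj₂ survives (removed-even⁺ even (successors-rank-≤⇒finite even below))
    where
    survives : G A α (suc j) (q , k)
    survives = subst (λ r → G A α r (q , k)) fq≡1+j (proj₁ (super k m<k q q∈S))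
    below : ∀ q' → q' ∈ δ A q (α k) → ∃ λ r → RankIs A α q' (suc k) r × r ≤ j
    below q' q'∈δq =
        f (suc k) q'
      , super (suc k) (m<n⇒m<1+n m<k) q'
          (subst (q' ∈_) (sym (tightStep-post (tightStep m<k))) (∈-post A q∈S q'∈δq))
      , ≤-pred (≤∧≢⇒< (subst (f (suc k) q' ≤_) fq≡1+j (tightStep-≤ (tightStep m<k) q∈S q'∈δq))
                       (λ eq → ∄ (q' , q'∈δq , trans eq (sym fq≡1+j))))

  sameRankSuccessor? : ∀ k q → Decidable λ q' → q' ∈ δ A q (α k) × f (suc k) q' ≡ f k q
  sameRankSuccessor? k q q' = (q' ∈? δ A q (α k)) ×-dec (f (suc k) q' ≟ f k q)

  θ : ℕ → Fin n → Fin n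
  θ k q = choose (sameRankSuccessor? k q) q

  θ-sameRank : ∀ {k} → m < k → SameRankSuccessor A (α k) (T k) (T (suc k)) (θ k)
  θ-sameRank {k} m<k {q} q∈S odd =
    choose-sound (sameRankSuccessor? k q) q (sameRank-exists m<k q∈S odd)

  module Along {k} (m<k : m < k) = ImageOfCore A (α k) (T k) (T (suc k)) (θ-sameRank m<k)

  -- Only the values at k > m matter; the fallback makes trunk (suc m) the initial core.
  trunk : ℕ → Subset n
  trunk zero = initialCore
  trunk (suc k) with m <? k
  ... | yes _ = image (θ k) (trunk k)
  ... | no _ = initialCore

  trunk-suc : ∀ {k} → m < k → trunk (suc k) ≡ image (θ k) (trunk k)
  trunk-suc {k} m<k with m <? k
  ... | yes _ = refl
  ... | no m≮k = contradiction m<k m≮k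

  trunk-first : trunk (suc m) ≡ initialCore
  trunk-first with m <? m
  ... | yes m<m = contradiction m<m (<-irrefl refl)
  ... | no _ = refl

  trunk-tightCore : ∀ k → m < k → IsTightCore (T k) (trunk k)
  trunk-tightCore (suc k) m<1+k with m<1+n⇒m<n∨m≡n m<1+k
  ... | inj₁ m<k = subst (IsTightCore (T (suc k))) (sym (trunk-suc m<k))
                     (Along.image-tightCore m<k (tightStep m<k) (trunk-tightCore k m<k))
  ... | inj₂ refl = subst (IsTightCore (T (suc m))) (sym trunk-first) initialCore-tightCore

  trunk-isTrunk : IsTrunk A α m T trunk
  trunk-isTrunk k m<k =
      trunk-tightCore k m<k
    , subst (BijStep A (α k) (trunk k)) (sym (trunk-suc m<k))
        (Along.image-bijStep m<k (trunk-tightCore k m<k))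

  trunk-sameRank : ∀ k → m < k → ∀ q → q ∈ trunk k →
    ∃ λ q' → q' ∈ trunk (suc k) × f k q ≡ f (suc k) q'
  trunk-sameRank k m<k q q∈C =
      θ k q
    , subst (θ k q ∈_) (sym (trunk-suc m<k)) (∈-image⁺ (θ k) (trunk k) q∈C)
    , sym (proj₂ (Along.sameRank-on-core m<k (trunk-tightCore k m<k) q∈C))

lemma3 : ∀ {n σ} → 1 ≤ σ → (A : BA n σ) (α : Word σ) (m : ℕ)
    (W : ℕ → Subset n) (T : ℕ → TState n) →
    IsAcceptingScheweRun A α (glue m W T) →
    SuperTight A α m T →
    ∃ λ (C : ℕ → Subset n) →
    IsTrunk A α m T C
    × (∀ k → m < k → ∀ q → q ∈ C k →
    ∃ λ q' → q' ∈ C (suc k) × TState.f (T k) q ≡ TState.f (T (suc k)) q')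
lemma3 _ A α m W T (run , _) super = trunk , trunk-isTrunk , trunk-sameRank
  where open SuperTightRun A α m W T run super
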